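{- Let $\sim$ be an equivalence relation on a non-empty set $X$, let $\mathbb{X}=\langle X,\sim\rangle$, and let $\{X_i : i\in I\}$ be the corresponding partition of $X$ into equivalence classes. Then $\mathbb{X}$ is reversible if and only if $\langle |X_i| : i\in I\rangle$ is a reversible sequence of cardinals. The same equivalence holds for graphs of the form $\mathbb{X}=\bigcup_{i\in I}\mathbb{X}_i$ where $\mathbb{X}_i$, $i\in I$, are pairwise disjoint non-empty complete graphs, and for posets of the form $\mathbb{X}=\bigcup_{i\in I}\mathbb{X}_i$ where $\mathbb{X}_i$, $i\in I$, are pairwise disjoint posets each isomorphic to a non-zero ordinal $\leq\omega$ (with its natural order); in each case $X_i$ denotes the domain of $\mathbb{X}_i$.
   Context: A relational structure $\mathbb{X}=\langle X,\rho\rangle$ is reversible iff every bijective homomorphism $f:\mathbb{X}\to\mathbb{X}$ (i.e. bijection $f$ with $\langle x,y\rangle\in\rho\Rightarrow\langle f(x),f(y)\rangle\in\rho$) is an automorphism. The disjoint union $\bigcup_{i\in I}\mathbb{X}_i$ of structures $\langle X_i,\rho_i\rangle$ with pairwise disjoint domains is $\langle\bigcup_i X_i,\bigcup_i\rho_i\rangle$. A sequence of non-zero cardinals $\langle\kappa_i:i\in I\rangle$ is reversible iff there is no non-injective surjection $f:I\to I$ such that $\kappa_j=\sum_{i\in f^{ -1}[\{j\}]}\kappa_i$ for all $j\in I$. -}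

module Defs where

open import Data.Nat using (ℕ; suc)
import Data.Nat as ℕ
open import Data.Fin using (Fin)
import Data.Fin as F
open import Data.Product using (Σ; _×_; _,_; proj₁)
open import Relation.Nullary using (¬_)
open import Relation.Binary.PropositionalEquality using (_≡_; _≢_)
open import Function.Definitions using (Injective; Surjective; Bijective)
open import Function.Bundles using (_↔_; Inverse)

Rel₀ : Set → Set₁
Rel₀ X = X → X → Set

IsHom : {X : Set} → Rel₀ X → (X → X) → Set
IsHom ρ f = ∀ {x y} → ρ x y → ρ (f x) (f y)

-- f is an automorphism: a bijection such that f and f⁻¹ are homomorphisms,
-- i.e. a bijection with  ρ x y  ⇔  ρ (f x) (f y).
IsAutomorphism : {X : Set} → Rel₀ X → (X → X) → Set
IsAutomorphism ρ f =
  Bijective _≡_ _≡_ f × IsHom ρ f × (∀ {x y} → ρ (f x) (f y) → ρ x y)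

Reversible : (X : Set) → Rel₀ X → Set
Reversible X ρ = (f : X → X) → Bijective _≡_ _≡_ f → IsHom ρ f → IsAutomorphism ρ f

-- Cardinals are represented by sets; cardinal equality |A| = |B| is the
-- existence of a bijection A ↔ B; the cardinal sum Σ_{i∈J} κ_i is the
-- cardinality of the disjoint union Σ (i : J) κ_i.
Fibre : {I : Set} → (I → I) → I → Set
Fibre {I} f j = Σ I (λ i → f i ≡ j)

ReversibleSeq : (I : Set) → (κ : I → Set) → Set
ReversibleSeq I κ =
  ¬ (Σ (I → I) λ f →
       Surjective _≡_ _≡_ f × ¬ Injective _≡_ _≡_ f ×
       ((j : I) → κ j ↔ Σ (Fibre f j) (λ p → κ (proj₁ p))))

-- Relation of the disjoint union ⋃_{i∈I} ⟨ A i , R i ⟩ on the domain Σ I A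
-- (the domains are made pairwise disjoint by tagging with i).
data UnionRel {I : Set} (A : I → Set) (R : (i : I) → Rel₀ (A i)) : Rel₀ (Σ I A) where
  inn : ∀ {i a b} → R i a b → UnionRel A R (i , a) (i , b)

CompleteGraph : (A : Set) → Rel₀ A
CompleteGraph A x y = x ≢ y

-- Non-zero ordinals ≤ ω : n+1 (for n : ℕ) and ω.
data OrdLeω : Set where
  succOrd : ℕ → OrdLeω
  ω       : OrdLeω

OrdCarrier : OrdLeω → Set
OrdCarrier (succOrd n) = Fin (suc n)
OrdCarrier ω           = ℕ

OrdLe : (α : OrdLeω) → Rel₀ (OrdCarrier α)
OrdLe (succOrd n) = F._≤_
OrdLe ω           = ℕ._≤_

Iso : (A : Set) → Rel₀ A → (B : Set) → Rel₀ B → Set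
Iso A R B S = Σ (A ↔ B) λ h →
  ∀ x y → (R x y → S (Inverse.to h x) (Inverse.to h y))
        × (S (Inverse.to h x) (Inverse.to h y) → R x y)

-- A bijective homomorphism F of a disjoint union of connected structures X_i maps each X_i into a
-- single X_(g i). Being a bijection, F then exhibits every X_j as the disjoint union of the X_i with
-- g i = j, so g is a surjection of the kind forbidden by reversibility of ⟨|X_i|⟩ unless g is
-- injective; and when g is injective, F cannot relate points of different components, so it is an
-- automorphism as soon as injective homomorphisms between components reflect the relation.
-- Conversely, a non-injective surjection f with |X_j| = Σ_{f i = j} |X_i| yields a bijection
-- gluing the X_i with f i = j into X_j; it is a homomorphism but no automorphism, since it merges
-- two components. For classes and complete graphs any gluing will do; for ordinals ≤ ω the gluing
-- is rearranged so that each X_i embeds monotonically, using that a subset of ℕ of cardinality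
-- β ≤ ω has order type β.

module Submission where

open import Defs
open import Level using (0ℓ)
open import Axiom.ExcludedMiddle using (ExcludedMiddle)
open import Axiom.UniquenessOfIdentityProofs.WithK using (uip)
open import Data.Empty using (⊥-elim)
open import Data.Fin as Fin using (Fin; toℕ; fromℕ<; punchOut)
open import Data.Fin.Properties using (pigeonhole; punchOut-injective; toℕ-injective; toℕ-fromℕ<; fromℕ<-injective)
import Data.Fin.Properties as Finₚ
open import Data.Nat using (ℕ; zero; suc; _≤_; _<_; _≤?_; _<?_; z≤n; s≤s)
open import Data.Nat.Induction using (<-rec)
open import Data.Nat.Properties
open import Data.Product using (Σ; ∃; _×_; _,_; proj₁; proj₂)
open import Data.Product.Properties using (,-injectiveʳ-UIP)
open import Data.Product.Function.Dependent.Propositional using (Σ-↔)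
open import Data.Sum using (_⊎_; inj₁; inj₂)
open import Data.Unit using (⊤)
open import Function using (_∘_; id)
open import Function.Bundles using (_⇔_; _↔_; Equivalence; Inverse; Bijection; mk↔ₛ′; mk⇔; mk⤖)
open import Function.Definitions using (Injective; Surjective; Bijective)
open import Function.Properties.Bijection using (⤖⇒↔)
open import Function.Properties.Inverse using (↔-refl; ↔-sym; ↔-trans; ↔⇒⤖)
open import Relation.Binary.Construct.Always using (Always)
open import Relation.Binary.PropositionalEquality
open import Relation.Binary.Definitions using (tri<; tri≈; tri>)
open import Relation.Binary.Structures using (IsEquivalence)
open import Relation.Nullary using (¬_; yes; no)

open Inverse using (to; from; strictlyInverseˡ)

↔⇒bijective : {A B : Set} (h : A ↔ B) → Bijective _≡_ _≡_ (to h)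
↔⇒bijective h = Bijection.bijective (↔⇒⤖ h)

bijective⇒↔ : {A B : Set} {f : A → B} → Bijective _≡_ _≡_ f → A ↔ B
bijective⇒↔ f-bij = ⤖⇒↔ (mk⤖ f-bij)

module _ {I : Set} {A : I → Set} where

  Σ-regroup : (f : I → I) → Σ I A ↔ Σ I (λ j → Σ (Fibre f j) (A ∘ proj₁))
  Σ-regroup f = mk↔ₛ′ (λ (i , a) → f i , (i , refl) , a) (λ (_ , (i , _) , a) → i , a)
                      (λ { (_ , (_ , refl) , _) → refl }) (λ _ → refl)

  Σ-fibre-proj₁ : ∀ j → A j ↔ Σ (Σ I A) (λ z → proj₁ z ≡ j)
  Σ-fibre-proj₁ j = mk↔ₛ′ (λ a → (j , a) , refl) (λ { ((_ , a) , refl) → a })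
                          (λ { (_ , refl) → refl }) (λ _ → refl)

≡-↔ : {I : Set} {i i' j : I} → i ≡ i' → (i ≡ j) ↔ (i' ≡ j)
≡-↔ refl = ↔-refl

fibrewise-↔ : {I : Set} {A B : I → Set} (Φ : Σ I A ↔ Σ I B) →
              (∀ z → proj₁ (to Φ z) ≡ proj₁ z) → ∀ j → A j ↔ B j
fibrewise-↔ Φ over j =
  ↔-trans (Σ-fibre-proj₁ j)
    (↔-trans (Σ-↔ Φ (λ {z} → ≡-↔ (sym (over z)))) (↔-sym (Σ-fibre-proj₁ j)))

lying-over⇒split : {I : Set} {A : I → Set} (F : Σ I A ↔ Σ I A) (g : I → I) →
                   (∀ z → proj₁ (to F z) ≡ g (proj₁ z)) →
                   ∀ j → A j ↔ Σ (Fibre g j) (A ∘ proj₁)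
lying-over⇒split F g over = fibrewise-↔ (↔-trans (↔-sym F) (Σ-regroup g))
  λ w → trans (sym (over (from F w))) (cong proj₁ (strictlyInverseˡ F w))

module _ {A B : Set} {R : Rel₀ A} {S : Rel₀ B} where

  Iso-sym : Iso A R B S → Iso B S A R
  Iso-sym (h , h-iso) = ↔-sym h , λ u v →
      (λ s → proj₂ (h-iso _ _) (subst₂ S (sym (strictlyInverseˡ h u)) (sym (strictlyInverseˡ h v)) s))
    , (λ r → subst₂ S (strictlyInverseˡ h u) (strictlyInverseˡ h v) (proj₁ (h-iso _ _) r))

  Reversible-respects-Iso : Iso A R B S → Reversible A R → Reversible B S
  Reversible-respects-Iso (h , h-iso) rev F F-bij F-hom = F-bij , F-hom , F-reflects
    where
    h⁻¹-iso : ∀ u v → (S u v → R (from h u) (from h v)) × (R (from h u) (from h v) → S u v)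
    h⁻¹-iso = proj₂ (Iso-sym (h , h-iso))
    conjugate : A ↔ A
    conjugate = ↔-trans h (↔-trans (bijective⇒↔ F-bij) (↔-sym h))
    conjugate-aut : IsAutomorphism R (to conjugate)
    conjugate-aut = rev (to conjugate) (↔⇒bijective conjugate)
      (λ r → proj₁ (h⁻¹-iso _ _) (F-hom (proj₁ (h-iso _ _) r)))
    F-reflects : ∀ {u v} → S (F u) (F v) → S u v
    F-reflects {u} {v} s =
      subst₂ S (strictlyInverseˡ h u) (strictlyInverseˡ h v)
        (proj₁ (h-iso _ _) (proj₂ (proj₂ conjugate-aut) (proj₁ (h⁻¹-iso _ _)
          (subst₂ (λ u' v' → S (F u') (F v')) (sym (strictlyInverseˡ h u)) (sym (strictlyInverseˡ h v)) s))))

Semiconnex : {A : Set} → Rel₀ A → Set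
Semiconnex R = ∀ a b → a ≡ b ⊎ R a b ⊎ R b a

module _ {I : Set} {A : I → Set} {R : (i : I) → Rel₀ (A i)} where

  UnionRel-sameComponent : ∀ {z w} → UnionRel A R z w → proj₁ z ≡ proj₁ w
  UnionRel-sameComponent (inn _) = refl

  UnionRel-semiconnex : (∀ i → Semiconnex (R i)) →
                        ∀ z w → proj₁ z ≡ proj₁ w → z ≡ w ⊎ UnionRel A R z w ⊎ UnionRel A R w z
  UnionRel-semiconnex connex (i , a) (.i , b) refl with connex i a b
  ... | inj₁ refl     = inj₁ refl
  ... | inj₂ (inj₁ r) = inj₂ (inj₁ (inn r))
  ... | inj₂ (inj₂ r) = inj₂ (inj₂ (inn r))

module ConnexUnion {I : Set} (A : I → Set) (R : (i : I) → Rel₀ (A i))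
                   (a₀ : (i : I) → A i) (connex : ∀ i → Semiconnex (R i)) where

  ρ : Rel₀ (Σ I A)
  ρ = UnionRel A R

  hom-preserves-components : ∀ {F} → IsHom ρ F →
                             ∀ {z w} → proj₁ z ≡ proj₁ w → proj₁ (F z) ≡ proj₁ (F w)
  hom-preserves-components {F} F-hom {z} {w} e with UnionRel-semiconnex connex z w e
  ... | inj₁ refl     = refl
  ... | inj₂ (inj₁ r) = UnionRel-sameComponent (F-hom r)
  ... | inj₂ (inj₂ r) = sym (UnionRel-sameComponent (F-hom r))

  automorphism-reflects-components : ∀ {F} → IsAutomorphism ρ F →
                                     ∀ {z w} → proj₁ (F z) ≡ proj₁ (F w) → proj₁ z ≡ proj₁ w
  automorphism-reflects-components {F} ((F-inj , _) , _ , F-reflects) {z} {w} e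
    with UnionRel-semiconnex connex (F z) (F w) e
  ... | inj₁ Fz≡Fw    = cong proj₁ (F-inj Fz≡Fw)
  ... | inj₂ (inj₁ r) = UnionRel-sameComponent (F-reflects r)
  ... | inj₂ (inj₂ r) = sym (UnionRel-sameComponent (F-reflects r))

  InjectiveHomsReflect : Set
  InjectiveHomsReflect = ∀ F → Injective _≡_ _≡_ F → IsHom ρ F →
                         ∀ {i} {a b : A i} → ρ (F (i , a)) (F (i , b)) → R i a b

  SplitsHomomorphically : Set₁
  SplitsHomomorphically = ∀ {K : Set} (c : K → I) j → A j ↔ Σ K (A ∘ c) →
    Σ (A j ↔ Σ K (A ∘ c)) λ H → ∀ k {a b} → R (c k) a b → R j (from H (k , a)) (from H (k , b))

  reversibleSeq⇒reversible : ExcludedMiddle 0ℓ → InjectiveHomsReflect →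
                             ReversibleSeq I A → Reversible (Σ I A) ρ
  reversibleSeq⇒reversible lem reflect rev F F-bij F-hom = F-bij , F-hom , F-reflects
    where
    F↔ : Σ I A ↔ Σ I A
    F↔ = bijective⇒↔ F-bij
    g : I → I
    g i = proj₁ (F (i , a₀ i))
    over : ∀ z → proj₁ (F z) ≡ g (proj₁ z)
    over _ = hom-preserves-components F-hom refl
    g-surjective : Surjective _≡_ _≡_ g
    g-surjective j = proj₁ (from F↔ (j , a₀ j))
                   , λ { refl → trans (sym (over _)) (cong proj₁ (strictlyInverseˡ F↔ _)) }
    g-injective : Injective _≡_ _≡_ g
    g-injective with lem {Injective _≡_ _≡_ g}
    ... | yes g-inj = g-inj
    ... | no ¬g-inj = ⊥-elim (rev (g , g-surjective , ¬g-inj , lying-over⇒split F↔ g over))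
    F-reflects : ∀ {z w} → ρ (F z) (F w) → ρ z w
    F-reflects {i , _} {i' , _} r
      with g-injective (trans (sym (over _)) (trans (UnionRel-sameComponent r) (over _)))
    ... | refl = inn (reflect F (proj₁ F-bij) F-hom r)

  reversible⇒reversibleSeq : SplitsHomomorphically → Reversible (Σ I A) ρ → ReversibleSeq I A
  reversible⇒reversibleSeq split rev (f , _ , ¬f-inj , H) = ¬f-inj f-injective
    where
    H' : ∀ j → A j ↔ Σ (Fibre f j) (A ∘ proj₁)
    H' j = proj₁ (split proj₁ j (H j))
    F↔ : Σ I A ↔ Σ I A
    F↔ = ↔-trans (Σ-regroup f) (Σ-↔ ↔-refl (↔-sym (H' _)))
    F-hom : IsHom ρ (to F↔)
    F-hom (inn {i} r) = inn (proj₂ (split proj₁ (f i) (H (f i))) (i , refl) r)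
    f-injective : Injective _≡_ _≡_ f
    f-injective {i} {i'} = automorphism-reflects-components (rev (to F↔) (↔⇒bijective F↔) F-hom)
                             {i , a₀ i} {i' , a₀ i'}

  reversible⇔reversibleSeq : ExcludedMiddle 0ℓ → InjectiveHomsReflect → SplitsHomomorphically →
                             Reversible (Σ I A) ρ ⇔ ReversibleSeq I A
  reversible⇔reversibleSeq lem reflect split =
    mk⇔ (reversible⇒reversibleSeq split) (reversibleSeq⇒reversible lem reflect)

module _ {X I : Set} (cls : X → I) where

  Class : I → Set
  Class i = Σ X λ x → cls x ≡ i

  Σ-Class-↔ : X ↔ Σ I Class
  Σ-Class-↔ = mk↔ₛ′ (λ x → cls x , x , refl) (proj₁ ∘ proj₂) (λ { (_ , _ , refl) → refl }) (λ _ → refl)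

sameComponent⇒UnionAlways : {I : Set} {A : I → Set} {z w : Σ I A} →
                            proj₁ z ≡ proj₁ w → UnionRel A (λ _ → Always) z w
sameComponent⇒UnionAlways {z = _ , _} {w = _ , _} refl = inn _

equivalence-reversible⇔reversibleSeq :
  ExcludedMiddle 0ℓ → {X : Set} (_∼_ : Rel₀ X) {I : Set} (cls : X → I) → Surjective _≡_ _≡_ cls →
  (∀ x y → (x ∼ y) ⇔ (cls x ≡ cls y)) → Reversible X _∼_ ⇔ ReversibleSeq I (Class cls)
equivalence-reversible⇔reversibleSeq lem _∼_ cls cls-surj ∼⇔ =
  mk⇔ (Equivalence.to classes ∘ Reversible-respects-Iso ∼≅classes)
      (Reversible-respects-Iso (Iso-sym ∼≅classes) ∘ Equivalence.from classes)
  where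
  ∼≅classes : Iso _ _∼_ _ (UnionRel (Class cls) (λ _ → Always))
  ∼≅classes = Σ-Class-↔ cls , λ x y →
      (sameComponent⇒UnionAlways ∘ Equivalence.to (∼⇔ x y))
    , (Equivalence.from (∼⇔ x y) ∘ UnionRel-sameComponent)
  open ConnexUnion (Class cls) (λ _ → Always) (λ i → proj₁ (cls-surj i) , proj₂ (cls-surj i) refl)
                   (λ _ _ _ → inj₂ (inj₁ _))
  classes : Reversible (Σ _ (Class cls)) ρ ⇔ ReversibleSeq _ (Class cls)
  classes = reversible⇔reversibleSeq lem (λ _ _ _ _ → _) (λ _ _ H → H , λ _ _ → _)

UnionCompleteGraph-irreflexive : {I : Set} {A : I → Set} {z : Σ I A} →
                                 ¬ UnionRel A (λ i → CompleteGraph (A i)) z z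
UnionCompleteGraph-irreflexive (inn a≢a) = a≢a refl

completeGraphs-reversible⇔reversibleSeq :
  ExcludedMiddle 0ℓ → {I : Set} (A : I → Set) → ((i : I) → A i) →
  Reversible (Σ I A) (UnionRel A (λ i → CompleteGraph (A i))) ⇔ ReversibleSeq I A
completeGraphs-reversible⇔reversibleSeq lem A a₀ = reversible⇔reversibleSeq lem reflect split
  where
  connex : ∀ i → Semiconnex (CompleteGraph (A i))
  connex i a b with lem {a ≡ b}
  ... | yes a≡b = inj₁ a≡b
  ... | no a≢b  = inj₂ (inj₁ a≢b)
  open ConnexUnion A (λ i → CompleteGraph (A i)) a₀ connex
  reflect : InjectiveHomsReflect
  reflect F _ _ r refl = UnionCompleteGraph-irreflexive r
  split : SplitsHomomorphically
  split c j H = H , λ k a≢b e → a≢b (,-injectiveʳ-UIP uip (proj₁ (↔⇒bijective (↔-sym H)) e))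

IsMinimal : {T : Set} (m : T → ℕ) (P : T → Set) → T → Set
IsMinimal m P t = P t × ∀ {t'} → P t' → m t ≤ m t'

strictlyMonotone⇒injective : {T : Set} (m r : T → ℕ) → Injective _≡_ _≡_ m →
                             (∀ {t t'} → m t < m t' → r t < r t') → Injective _≡_ _≡_ r
strictlyMonotone⇒injective m r m-inj r-mono {t} {t'} rt≡rt' with <-cmp (m t) (m t')
... | tri< lt _ _ = ⊥-elim (<⇒≢ (r-mono lt) rt≡rt')
... | tri≈ _ eq _ = m-inj eq
... | tri> _ _ gt = ⊥-elim (<⇒≢ (r-mono gt) (sym rt≡rt'))

bounded⇒¬injective : (h : ℕ → ℕ) (N : ℕ) → (∀ k → h k ≤ N) → ¬ Injective _≡_ _≡_ h
bounded⇒¬injective h N bound h-inj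
  with pigeonhole (n<1+n (suc N)) (λ x → fromℕ< (s≤s (bound (toℕ x))))
... | i , j , i<j , eq = Finₚ.<-irrefl (toℕ-injective (h-inj (fromℕ<-injective _ _ _ _ eq))) i<j

countBelow : ∀ {k} → (Fin k → ℕ) → ℕ → ℕ
countBelow {zero}  v t = 0
countBelow {suc k} v t with v Fin.zero <? t
... | yes _ = suc (countBelow (v ∘ Fin.suc) t)
... | no  _ = countBelow (v ∘ Fin.suc) t

countBelow-≤ : ∀ {k} (v : Fin k → ℕ) t → countBelow v t ≤ k
countBelow-≤ {zero}  v t = z≤n
countBelow-≤ {suc k} v t with v Fin.zero <? t
... | yes _ = s≤s (countBelow-≤ (v ∘ Fin.suc) t)
... | no  _ = m≤n⇒m≤1+n (countBelow-≤ (v ∘ Fin.suc) t)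

countBelow-mono : ∀ {k} (v : Fin k → ℕ) {t t'} → t ≤ t' → countBelow v t ≤ countBelow v t'
countBelow-mono {zero}  v t≤t' = z≤n
countBelow-mono {suc k} v {t} {t'} t≤t' with v Fin.zero <? t | v Fin.zero <? t'
... | yes _   | yes _   = s≤s (countBelow-mono (v ∘ Fin.suc) t≤t')
... | yes v<t | no  v≮t' = ⊥-elim (v≮t' (<-≤-trans v<t t≤t'))
... | no  _   | yes _   = m≤n⇒m≤1+n (countBelow-mono (v ∘ Fin.suc) t≤t')
... | no  _   | no  _   = countBelow-mono (v ∘ Fin.suc) t≤t'

countBelow-strict : ∀ {k} (v : Fin k → ℕ) {t t'} (x : Fin k) → t ≤ v x → v x < t' →
                    countBelow v t < countBelow v t'
countBelow-strict {suc k} v {t} {t'} x t≤vx vx<t' with v Fin.zero <? t | v Fin.zero <? t'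
countBelow-strict v Fin.zero t≤vx _ | yes v<t | _ = ⊥-elim (<⇒≱ v<t t≤vx)
countBelow-strict v (Fin.suc x) t≤vx vx<t' | yes _ | yes _ =
  s≤s (countBelow-strict (v ∘ Fin.suc) x t≤vx vx<t')
countBelow-strict v x t≤vx vx<t' | yes v<t | no v≮t' =
  ⊥-elim (v≮t' (<-≤-trans v<t (≤-trans t≤vx (<⇒≤ vx<t'))))
countBelow-strict v Fin.zero t≤vx vx<t' | no _ | yes _ =
  s≤s (countBelow-mono (v ∘ Fin.suc) (≤-trans t≤vx (<⇒≤ vx<t')))
countBelow-strict v Fin.zero _ vx<t' | no _ | no v≮t' = ⊥-elim (v≮t' vx<t')
countBelow-strict v (Fin.suc x) t≤vx vx<t' | no _ | yes _ =
  m<n⇒m<1+n (countBelow-strict (v ∘ Fin.suc) x t≤vx vx<t')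
countBelow-strict v (Fin.suc x) t≤vx vx<t' | no _ | no _ =
  countBelow-strict (v ∘ Fin.suc) x t≤vx vx<t'

module _ (lem : ExcludedMiddle 0ℓ) where

  least-ℕ : (P : ℕ → Set) → ∀ {n} → P n → ∃ (IsMinimal id P)
  least-ℕ P {n} = <-rec (λ n → P n → ∃ (IsMinimal id P)) step n
    where
    step : ∀ n → (∀ {k} → k < n → P k → ∃ (IsMinimal id P)) → P n → ∃ (IsMinimal id P)
    step n rec pn with lem {∃ λ k → k < n × P k}
    ... | yes (_ , k<n , pk) = rec k<n pk
    ... | no ∄               = n , pn , λ pk → ≮⇒≥ λ k<n → ∄ (_ , k<n , pk)

  minimal : {T : Set} (m : T → ℕ) (P : T → Set) → Σ T P → ∃ (IsMinimal m P)
  minimal m P (t , pt) with least-ℕ (λ n → ∃ λ t → P t × m t ≡ n) (t , pt , refl)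
  ... | _ , (t₀ , pt₀ , refl) , least = t₀ , pt₀ , λ pt' → least (_ , pt' , refl)

  Fin-injective⇒surjective : ∀ {n} (h : Fin n → Fin n) → Injective _≡_ _≡_ h → ∀ y → ∃ λ x → h x ≡ y
  Fin-injective⇒surjective {suc n} h h-inj y with lem {∃ λ x → h x ≡ y}
  ... | yes hit = hit
  ... | no ∄ with pigeonhole (n<1+n n) (λ x → punchOut {i = y} (λ y≡hx → ∄ (x , sym y≡hx)))
  ...   | i , j , i<j , eq =
    ⊥-elim (Finₚ.<-irrefl (h-inj (punchOut-injective (λ e → ∄ (i , sym e)) (λ e → ∄ (j , sym e)) eq)) i<j)

  ℕ-injective⇒unbounded : (h : ℕ → ℕ) → Injective _≡_ _≡_ h → ∀ N → ∃ λ k → N < h k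
  ℕ-injective⇒unbounded h h-inj N with lem {∃ λ k → N < h k}
  ... | yes above = above
  ... | no ∄ = ⊥-elim (bounded⇒¬injective h N (λ k → ≮⇒≥ λ N<hk → ∄ (k , N<hk)) h-inj)

  Fin-increasing-enumeration : ∀ n {T : Set} (m : T → ℕ) → Injective _≡_ _≡_ m → Fin (suc n) ↔ T →
    Σ (Fin (suc n) ↔ T) λ E → ∀ {x y} → x Fin.≤ y → m (to E x) ≤ m (to E y)
  Fin-increasing-enumeration n {T} m m-inj c = ↔-sym rank↔ , monotone
    where
    v : Fin (suc n) → ℕ
    v = m ∘ to c
    rank : T → ℕ
    rank t = countBelow v (m t)
    v-from : ∀ t → v (from c t) ≡ m t
    v-from t = cong m (strictlyInverseˡ c t)
    rank-below : ∀ {t s} → m t < s → rank t < countBelow v s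
    rank-below {t} lt =
      countBelow-strict v (from c t) (≤-reflexive (sym (v-from t))) (subst (_< _) (sym (v-from t)) lt)
    rank< : ∀ t → rank t < suc n
    rank< t = <-≤-trans (rank-below (n<1+n (m t))) (countBelow-≤ v (suc (m t)))
    rk : T → Fin (suc n)
    rk t = fromℕ< (rank< t)
    toℕ-rk : ∀ t → toℕ (rk t) ≡ rank t
    toℕ-rk t = toℕ-fromℕ< (rank< t)
    rk-injective : Injective _≡_ _≡_ rk
    rk-injective {t} {t'} e = strictlyMonotone⇒injective m rank m-inj rank-below
      (trans (sym (toℕ-rk t)) (trans (cong toℕ e) (toℕ-rk t')))
    rk-surjective : Surjective _≡_ _≡_ rk
    rk-surjective y with Fin-injective⇒surjective (rk ∘ to c) (proj₁ (↔⇒bijective c) ∘ rk-injective) y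
    ... | x , rk[x]≡y = to c x , λ { refl → rk[x]≡y }
    rank↔ : T ↔ Fin (suc n)
    rank↔ = bijective⇒↔ (rk-injective , rk-surjective)
    rank-from : ∀ x → rank (from rank↔ x) ≡ toℕ x
    rank-from x = trans (sym (toℕ-rk _)) (cong toℕ (strictlyInverseˡ rank↔ x))
    monotone : ∀ {x y} → x Fin.≤ y → m (from rank↔ x) ≤ m (from rank↔ y)
    monotone {x} {y} x≤y = ≮⇒≥ λ lt → <⇒≱ (subst₂ _<_ (rank-from y) (rank-from x) (rank-below lt)) x≤y

  ℕ-increasing-enumeration : {T : Set} (m : T → ℕ) → Injective _≡_ _≡_ m → ℕ ↔ T →
    Σ (ℕ ↔ T) λ E → ∀ {x y} → x ≤ y → m (to E x) ≤ m (to E y)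
  ℕ-increasing-enumeration {T} m m-inj c = E , e-mono
    where
    above : ∀ t → ∃ λ t' → m t < m t'
    above t with ℕ-injective⇒unbounded (m ∘ to c) (proj₁ (↔⇒bijective c) ∘ m-inj) (m t)
    ... | k , lt = to c k , lt
    first : ∃ (IsMinimal m (λ _ → ⊤))
    first = minimal m _ (to c 0 , _)
    next : ∀ t → ∃ (IsMinimal m (λ t' → m t < m t'))
    next t = minimal m _ (above t)
    e : ℕ → T
    e zero    = proj₁ first
    e (suc k) = proj₁ (next (e k))
    e-step : ∀ k → m (e k) < m (e (suc k))
    e-step k = proj₁ (proj₂ (next (e k)))
    e-strict : ∀ {k k'} → k < k' → m (e k) < m (e k')
    e-strict {k} {suc k'} (s≤s k≤k') with m≤n⇒m<n∨m≡n k≤k'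
    ... | inj₁ k<k' = <-trans (e-strict k<k') (e-step k')
    ... | inj₂ refl = e-step k
    e-mono : ∀ {k k'} → k ≤ k' → m (e k) ≤ m (e k')
    e-mono k≤k' with m≤n⇒m<n∨m≡n k≤k'
    ... | inj₁ k<k' = <⇒≤ (e-strict k<k')
    ... | inj₂ refl = ≤-refl
    e-injective : Injective _≡_ _≡_ e
    e-injective = strictlyMonotone⇒injective id (m ∘ e) id e-strict ∘ cong m
    k≤m[e[k]] : ∀ k → k ≤ m (e k)
    k≤m[e[k]] zero    = z≤n
    k≤m[e[k]] (suc k) = <-≤-trans (s≤s (k≤m[e[k]] k)) (e-step k)
    e-covers : ∀ k t → m t ≤ m (e k) → ∃ λ k' → e k' ≡ t
    e-covers zero    t le = zero , m-inj (≤-antisym (proj₂ (proj₂ first) _) le)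
    e-covers (suc k) t le with m t ≤? m (e k)
    ... | yes le' = e-covers k t le'
    ... | no  nle = suc k , m-inj (≤-antisym (proj₂ (proj₂ (next (e k))) (≰⇒> nle)) le)
    E : ℕ ↔ T
    E = bijective⇒↔ (e-injective , λ t → let k , e[k]≡t = e-covers (m t) t (k≤m[e[k]] (m t))
                                            in k , λ { refl → e[k]≡t })

  increasing-enumeration : (β : OrdLeω) {T : Set} (m : T → ℕ) → Injective _≡_ _≡_ m → OrdCarrier β ↔ T →
    Σ (OrdCarrier β ↔ T) λ E → ∀ {x y} → OrdLe β x y → m (to E x) ≤ m (to E y)
  increasing-enumeration (succOrd n) = Fin-increasing-enumeration n
  increasing-enumeration ω           = ℕ-increasing-enumeration

ordinalZero : (β : OrdLeω) → OrdCarrier β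
ordinalZero (succOrd _) = Fin.zero
ordinalZero ω           = zero

ordinalCode : (β : OrdLeω) → OrdCarrier β → ℕ
ordinalCode (succOrd _) = toℕ
ordinalCode ω           = id

ordinalCode-injective : ∀ β → Injective _≡_ _≡_ (ordinalCode β)
ordinalCode-injective (succOrd _) = toℕ-injective
ordinalCode-injective ω           = id

OrdLe⇔≤ : ∀ β {x y} → OrdLe β x y ⇔ ordinalCode β x ≤ ordinalCode β y
OrdLe⇔≤ (succOrd _) = mk⇔ id id
OrdLe⇔≤ ω           = mk⇔ id id

ordinals-reversible⇔reversibleSeq :
  ExcludedMiddle 0ℓ → {I : Set} (A : I → Set) (R : (i : I) → Rel₀ (A i)) (α : I → OrdLeω) →
  ((i : I) → Iso (A i) (R i) (OrdCarrier (α i)) (OrdLe (α i))) →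
  Reversible (Σ I A) (UnionRel A R) ⇔ ReversibleSeq I A
ordinals-reversible⇔reversibleSeq lem A R α ι = reversible⇔reversibleSeq lem reflect split
  where
  φ : ∀ i → A i ↔ OrdCarrier (α i)
  φ i = proj₁ (ι i)
  code : ∀ i → A i → ℕ
  code i = ordinalCode (α i) ∘ to (φ i)
  code-injective : ∀ i → Injective _≡_ _≡_ (code i)
  code-injective i = proj₁ (↔⇒bijective (φ i)) ∘ ordinalCode-injective (α i)
  R⇒≤ : ∀ i {a b} → R i a b → code i a ≤ code i b
  R⇒≤ i {a} {b} = Equivalence.to (OrdLe⇔≤ (α i)) ∘ proj₁ (proj₂ (ι i) a b)
  ≤⇒R : ∀ i {a b} → code i a ≤ code i b → R i a b
  ≤⇒R i {a} {b} = proj₂ (proj₂ (ι i) a b) ∘ Equivalence.from (OrdLe⇔≤ (α i))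
  connex : ∀ i → Semiconnex (R i)
  connex i a b with ≤-total (code i a) (code i b)
  ... | inj₁ a≤b = inj₂ (inj₁ (≤⇒R i a≤b))
  ... | inj₂ b≤a = inj₂ (inj₂ (≤⇒R i b≤a))
  open ConnexUnion A R (λ i → from (φ i) (ordinalZero (α i))) connex
  ρ-antisym : ∀ {z w} → ρ z w → ρ w z → z ≡ w
  ρ-antisym (inn {i} r) (inn r') = cong (i ,_) (code-injective i (≤-antisym (R⇒≤ i r) (R⇒≤ i r')))
  reflect : InjectiveHomsReflect
  reflect F F-inj F-hom {i} {a} {b} r with ≤-total (code i a) (code i b)
  ... | inj₁ a≤b = ≤⇒R i a≤b
  ... | inj₂ b≤a = subst (R i a) (,-injectiveʳ-UIP uip (F-inj (ρ-antisym r (F-hom (inn (≤⇒R i b≤a))))))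
                         (≤⇒R i ≤-refl)
  split : SplitsHomomorphically
  split c j H = ↔-trans H (↔-sym (Σ-↔ ↔-refl (λ {k} → σ k)))
              , λ k r → ≤⇒R j (proj₂ (enumeration k) (proj₁ (proj₂ (ι (c k)) _ _) r))
    where
    m : ∀ k → A (c k) → ℕ
    m k a = code j (from H (k , a))
    m-injective : ∀ k → Injective _≡_ _≡_ (m k)
    m-injective k = ,-injectiveʳ-UIP uip ∘ proj₁ (↔⇒bijective (↔-sym H)) ∘ code-injective j
    enumeration : ∀ k → Σ (OrdCarrier (α (c k)) ↔ A (c k)) λ E →
                  ∀ {x y} → OrdLe (α (c k)) x y → m k (to E x) ≤ m k (to E y)
    enumeration k = increasing-enumeration lem (α (c k)) (m k) (m-injective k) (↔-sym (φ (c k)))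
    σ : ∀ k → A (c k) ↔ A (c k)
    σ k = ↔-trans (φ (c k)) (proj₁ (enumeration k))

theorem3p2 : ExcludedMiddle 0ℓ →
    ((X : Set) (_∼_ : Rel₀ X) → IsEquivalence _∼_ → X →
     (I : Set) (cls : X → I) → Surjective _≡_ _≡_ cls →
     (∀ x y → (x ∼ y) ⇔ (cls x ≡ cls y)) →
     Reversible X _∼_ ⇔ ReversibleSeq I (λ i → Σ X (λ x → cls x ≡ i)))
    ×
    ((I : Set) (A : I → Set) → ((i : I) → A i) →
     Reversible (Σ I A) (UnionRel A (λ i → CompleteGraph (A i))) ⇔ ReversibleSeq I A)
    ×
    ((I : Set) (A : I → Set) (R : (i : I) → Rel₀ (A i)) (α : I → OrdLeω) →
     ((i : I) → Iso (A i) (R i) (OrdCarrier (α i)) (OrdLe (α i))) →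
     Reversible (Σ I A) (UnionRel A R) ⇔ ReversibleSeq I A)
-- The equivalence axioms follow from the description of ∼ through cls, and no element of X is needed.
theorem3p2 lem =
    (λ X _∼_ _ _ I → equivalence-reversible⇔reversibleSeq lem _∼_)
  , (λ I → completeGraphs-reversible⇔reversibleSeq lem)
  , (λ I → ordinals-reversible⇔reversibleSeq lem)
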